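{- $\mathcal{ALC}\iota_L<\mathcal{ALC}\iota_G=\mathcal{ALC}\iota$; that is, $\mathcal{ALC}\iota_L$ is strictly less expressive than $\mathcal{ALC}\iota_G$, and $\mathcal{ALC}\iota_G$ and $\mathcal{ALC}\iota$ are equally expressive.
   Context: $\mathcal{ALC}\iota$ concepts: $C ::= A \mid \neg C \mid (C\sqcap C) \mid \exists r.C \mid \{\iota C\} \mid \iota C.C$ ($A$ atomic concept, $r$ role). $\mathcal{ALC}\iota_L$: fragment without $\iota C.D$; $\mathcal{ALC}\iota_G$: fragment without $\{\iota C\}$. Semantics over interpretations $\mathcal{I}=(\Delta^{\mathcal{I}},\cdot^{\mathcal{I}})$: standard for $\neg,\sqcap,\exists r$; $(\{\iota C\})^{\mathcal{I}}=\{d\}$ if $C^{\mathcal{I}}=\{d\}$, else $\emptyset$; $(\iota C.D)^{\mathcal{I}}=\Delta^{\mathcal{I}}$ if $C^{\mathcal{I}}=\{d\}\subseteq D^{\mathcal{I}}$ for some $d$, else $\emptyset$. Two concepts are equivalent if they have the same extension in every interpretation. $\mathcal{L}\le\mathcal{L}'$ means every $\mathcal{L}$ concept has an equivalent $\mathcal{L}'$ concept; $\mathcal{L}<\mathcal{L}'$ means $\mathcal{L}\le\mathcal{L}'$ and not $\mathcal{L}'\le\mathcal{L}$; $\mathcal{L}=\mathcal{L}'$ means $\mathcal{L}\le\mathcal{L}'$ and $\mathcal{L}'\le\mathcal{L}$. -}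

module Defs where

open import Data.Nat using (ℕ)
open import Data.Product using (Σ; _×_; ∃; _,_)
open import Data.Empty using (⊥)
open import Data.Unit using (⊤)
open import Relation.Nullary using (¬_)
open import Relation.Binary.PropositionalEquality using (_≡_)
open import Function.Bundles using (_⇔_)

ConceptName : Set
ConceptName = ℕ

RoleName : Set
RoleName = ℕ

-- ALCι concepts:  C ::= A | ¬C | C ⊓ C | ∃r.C | {ιC} | ιC.C
data Concept : Set where
  atom  : ConceptName → Concept
  neg   : Concept → Concept
  conj  : Concept → Concept → Concept
  exR   : RoleName → Concept → Concept
  ιL    : Concept → Concept
  ιG    : Concept → Concept → Concept

data IsL : Concept → Set where
  atom : ∀ {A} → IsL (atom A)
  neg  : ∀ {C} → IsL C → IsL (neg C)
  conj : ∀ {C D} → IsL C → IsL D → IsL (conj C D)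
  exR  : ∀ {r C} → IsL C → IsL (exR r C)
  ιL   : ∀ {C} → IsL C → IsL (ιL C)

data IsG : Concept → Set where
  atom : ∀ {A} → IsG (atom A)
  neg  : ∀ {C} → IsG C → IsG (neg C)
  conj : ∀ {C D} → IsG C → IsG D → IsG (conj C D)
  exR  : ∀ {r C} → IsG C → IsG (exR r C)
  ιG   : ∀ {C D} → IsG C → IsG D → IsG (ιG C D)

IsFull : Concept → Set
IsFull _ = ⊤

-- Interpretations: a domain with extensions of concept and role names.
-- (The domain is not required to be non-empty; nothing below depends on it.)
record Interpretation : Set₁ where
  field
    Δ    : Set
    conI : ConceptName → Δ → Set
    roleI : RoleName → Δ → Δ → Set

open Interpretation public

⟦_⟧ : Concept → (I : Interpretation) → Δ I → Set
⟦ atom A ⟧ I d = conI I A d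
⟦ neg C ⟧ I d = ¬ (⟦ C ⟧ I d)
⟦ conj C D ⟧ I d = ⟦ C ⟧ I d × ⟦ D ⟧ I d
⟦ exR r C ⟧ I d = Σ (Δ I) λ e → roleI I r d e × ⟦ C ⟧ I e
⟦ ιL C ⟧ I d = ⟦ C ⟧ I d × (∀ e → ⟦ C ⟧ I e → e ≡ d)
⟦ ιG C D ⟧ I d =
  Σ (Δ I) λ e → ⟦ C ⟧ I e × (∀ x → ⟦ C ⟧ I x → x ≡ e) × ⟦ D ⟧ I e

_≣_ : Concept → Concept → Set₁
C ≣ D = ∀ (I : Interpretation) (d : Δ I) → ⟦ C ⟧ I d ⇔ ⟦ D ⟧ I d

Fragment : Set₁
Fragment = Concept → Set

_≼_ : Fragment → Fragment → Set₁
L ≼ L' = ∀ C → L C → Σ Concept λ C' → L' C' × (C ≣ C')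

_≺_ : Fragment → Fragment → Set₁
L ≺ L' = (L ≼ L') × ¬ (L' ≼ L)

_≋_ : Fragment → Fragment → Set₁
L ≋ L' = (L ≼ L') × (L' ≼ L)

{-# OPTIONS --safe #-}

-- Local descriptions are definable by global ones, {ιC} ≡ C ⊓ ιC.C, and
-- translating every {ιC} this way turns ALCι into ALCι_G.  Conversely ιA.A
-- is not expressible in ALCι_L.  Take two interpretations without roles, on
-- infinitely many points: in one, every concept name denotes a single extra
-- point; in the other, every concept name is empty.  No ALCι_L concept
-- distinguishes a non-extra point of the first from a point of the second,
-- yet ιA.A holds everywhere in the first and nowhere in the second.
module Submission where

open import Defs
open import Data.Empty using (⊥; ⊥-elim)
open import Data.Maybe using (Maybe; just; nothing)
open import Data.Maybe.Properties using (just-injective)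
open import Data.Nat using (ℕ; suc)
open import Data.Nat.Properties using (1+n≢n)
open import Data.Product using (Σ; _×_; _,_)
open import Data.Product.Function.Dependent.Propositional using (Σ-⇔)
open import Data.Product.Function.NonDependent.Propositional using (_×-⇔_)
open import Data.Unit using (tt)
open import Function.Bundles using (_⇔_; mk⇔; Equivalence)
open import Function.Construct.Composition using (_⇔-∘_)
open import Function.Construct.Identity using (⇔-id; ↠-id)
open import Function.Related.TypeIsomorphisms using (¬-cong-⇔)
open import Relation.Binary.PropositionalEquality using (_≡_; refl; sym; trans)
open import Relation.Nullary using (¬_)

open Equivalence

Σ-cong-⇔ : ∀ {X : Set} {A B : X → Set} → (∀ x → A x ⇔ B x) → Σ X A ⇔ Σ X B
Σ-cong-⇔ {X} A⇔B = Σ-⇔ (↠-id X) (λ {x} → A⇔B x)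

unique-cong-⇔ : ∀ {X : Set} {P Q : X → Set} {e : X} → (∀ x → P x ⇔ Q x) →
                (∀ x → P x → x ≡ e) ⇔ (∀ x → Q x → x ≡ e)
unique-cong-⇔ P⇔Q = mk⇔ (λ u x qx → u x (from (P⇔Q x) qx))
                        (λ u x px → u x (to (P⇔Q x) px))

ιL≣conj-ιG : ∀ C → ιL C ≣ conj C (ιG C C)
ιL≣conj-ιG C I d = mk⇔
  (λ (c , u) → c , d , c , u , c)
  (λ (c , e , _ , u , _) → c , λ x cx → trans (u x cx) (sym (u d c)))

elimιL : Concept → Concept
elimιL (atom A)   = atom A
elimιL (neg C)    = neg (elimιL C)
elimιL (conj C D) = conj (elimιL C) (elimιL D)
elimιL (exR r C)  = exR r (elimιL C)
elimιL (ιL C)     = conj (elimιL C) (ιG (elimιL C) (elimιL C))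
elimιL (ιG C D)   = ιG (elimιL C) (elimιL D)

elimιL-IsG : ∀ C → IsG (elimιL C)
elimιL-IsG (atom A)   = atom
elimιL-IsG (neg C)    = neg (elimιL-IsG C)
elimιL-IsG (conj C D) = conj (elimιL-IsG C) (elimιL-IsG D)
elimιL-IsG (exR r C)  = exR (elimιL-IsG C)
elimιL-IsG (ιL C)     = conj (elimιL-IsG C) (ιG (elimιL-IsG C) (elimιL-IsG C))
elimιL-IsG (ιG C D)   = ιG (elimιL-IsG C) (elimιL-IsG D)

elimιL-≣ : ∀ C → C ≣ elimιL C
elimιL-≣ (atom A)   I d = ⇔-id _
elimιL-≣ (neg C)    I d = ¬-cong-⇔ (elimιL-≣ C I d)
elimιL-≣ (conj C D) I d = elimιL-≣ C I d ×-⇔ elimιL-≣ D I d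
elimιL-≣ (exR r C)  I d = Σ-cong-⇔ (λ e → ⇔-id _ ×-⇔ elimιL-≣ C I e)
elimιL-≣ (ιL C)     I d =
  ιL≣conj-ιG (elimιL C) I d ⇔-∘ (elimιL-≣ C I d ×-⇔ unique-cong-⇔ (elimιL-≣ C I))
elimιL-≣ (ιG C D)   I d = Σ-cong-⇔ λ e →
  elimιL-≣ C I e ×-⇔ unique-cong-⇔ (elimιL-≣ C I) ×-⇔ elimιL-≣ D I e

IsFull≼IsG : IsFull ≼ IsG
IsFull≼IsG C _ = elimιL C , elimιL-IsG C , elimιL-≣ C

IsG≼IsFull : IsG ≼ IsFull
IsG≼IsFull C _ = C , tt , λ _ _ → ⇔-id _

atomsSingleton : Interpretation
atomsSingleton = record
  { Δ = Maybe ℕ ; conI = λ _ x → x ≡ nothing ; roleI = λ _ _ _ → ⊥ }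

atomsEmpty : Interpretation
atomsEmpty = record { Δ = ℕ ; conI = λ _ _ → ⊥ ; roleI = λ _ _ _ → ⊥ }

IsL-indistinguishable : ∀ {C} → IsL C → ∀ n m →
             ⟦ C ⟧ atomsSingleton (just n) ⇔ ⟦ C ⟧ atomsEmpty m
IsL-indistinguishable atom       n m = mk⇔ (λ ()) (λ ())
IsL-indistinguishable (neg C)    n m = ¬-cong-⇔ (IsL-indistinguishable C n m)
IsL-indistinguishable (conj C D) n m = IsL-indistinguishable C n m ×-⇔ IsL-indistinguishable D n m
IsL-indistinguishable (exR C)    n m = mk⇔ (λ ()) (λ ())
-- By the induction hypothesis C holds at every point just n, or at none, and
-- likewise on ℕ; so its extension there is never a singleton.
IsL-indistinguishable (ιL C)     n m = mk⇔
  (λ (c , u) → ⊥-elim (1+n≢n (just-injective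
     (u (just (suc n)) (from (IsL-indistinguishable C (suc n) m) (to (IsL-indistinguishable C n m) c))))))
  (λ (c , u) → ⊥-elim (1+n≢n
     (u (suc m) (to (IsL-indistinguishable C n (suc m)) (from (IsL-indistinguishable C n m) c)))))

ιA·A : Concept
ιA·A = ιG (atom 0) (atom 0)

ιA·A-holds : ⟦ ιA·A ⟧ atomsSingleton (just 0)
ιA·A-holds = nothing , refl , (λ _ x≡nothing → x≡nothing) , refl

ιA·A-fails : ¬ ⟦ ιA·A ⟧ atomsEmpty 0
ιA·A-fails (_ , () , _)

IsG⋠IsL : ¬ (IsG ≼ IsL)
IsG⋠IsL IsG≼IsL =
  let (C , C-IsL , ιA·A≣C) = IsG≼IsL ιA·A (ιG atom atom)
  in ιA·A-fails (from (ιA·A≣C atomsEmpty 0)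
       (to (IsL-indistinguishable C-IsL 0 0) (to (ιA·A≣C atomsSingleton (just 0)) ιA·A-holds)))

theorem3 : (IsL ≺ IsG) × (IsG ≋ IsFull)
theorem3 = ((λ C _ → IsFull≼IsG C tt) , IsG⋠IsL) , (IsG≼IsFull , IsFull≼IsG)
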